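{- Let $k\ge 1$ and let $G$ be a $k$-cluster with initial clique $H\cong K_{k+1}$, and let $S(G)$ be as defined in the context. Then: (1) if $|S(G)|\ge 3$, then $Z_+(G)=k+1$; (2) if $|S(G)|<3$, then $Z_+(G)=k$; (3) if $|S(G)|=k+1$ and $k$ is even, then $T(G)=\lceil \frac{k+1}{2}\rceil+1$; (4) if $|S(G)|<k+1$ and $k$ is even, then $T(G)=\lceil \frac{k+1}{2}\rceil$.
   Context: All graphs are finite and simple. A $k$-cluster is a graph constructed recursively by starting with a complete graph $H=K_{k+1}$ and repeatedly adding a new vertex adjacent to exactly $k$ of the vertices of $H$ (i.e. to a $k$-clique contained in the original $H$), and to no other vertices. $S(G)$ is the set of all distinct $k$-cliques $H'\subset H$ such that $H'\cup\{v\}$ is a clique of size $k+1$ in $G$ for some $v\in V(G)\setminus V(H)$. Positive zero forcing: given a set $B$ of black vertices, let $W_1,\dots,W_m$ be the vertex sets of the components of $G\setminus B$; if $u\in B$ and $w$ is the only white neighbour of $u$ in the subgraph induced by $W_i\cup B$, then $u$ may force $w$ black. A positive zero forcing set is an initial black set from which repeated forcing blackens all vertices; $Z_+(G)$ is its minimum size. $T(G)$, the tree cover number, is the minimum number of vertex-disjoint induced trees covering $V(G)$. -}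

module Defs where

open import Data.Nat using (ℕ; zero; suc; _+_; _≤_; _<_)
open import Data.Fin using (Fin; splitAt; join)
open import Data.Fin.Subset using (Subset; _∈_; _∉_; ∣_∣; _∪_; ⁅_⁆)
open import Data.Sum using (_⊎_; inj₁; inj₂)
open import Data.Product using (Σ; ∃; _×_; _,_)
open import Data.Empty using (⊥)
open import Data.List using (List; []; _∷_; length)
open import Data.List.Relation.Unary.All using (All)
open import Data.List.Relation.Unary.Linked using (Linked)
open import Data.List.Relation.Unary.Unique.Propositional using (Unique)
import Data.List.Membership.Propositional as LMem
open import Relation.Binary.PropositionalEquality using (_≡_; _≢_)
open import Relation.Nullary using (¬_)
open import Function.Bundles using (_⇔_)

record Graph : Set₁ where
  field
    n   : ℕ
    Adj : Fin n → Fin n → Set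
open Graph public

HasSize : {A : Set} → (A → Set) → ℕ → Set
HasSize {A} P s = Σ (List A) λ xs →
  length xs ≡ s × Unique xs × (∀ x → P x ⇔ (x LMem.∈ xs))

data Reach (G : Graph) (P : Fin (n G) → Set) : Fin (n G) → Fin (n G) → Set where
  here : ∀ {x} → P x → Reach G P x x
  step : ∀ {x y z} → P x → Adj G x y → Reach G P y z → Reach G P x z

-- With black set B, the component of G∖B containing a white vertex w is
-- the set of white vertices w' with Reach G (_∉ B) w w'.

PForce : (G : Graph) → Subset (n G) → Fin (n G) → Fin (n G) → Set
PForce G B u w =
  u ∈ B × w ∉ B × Adj G u w ×
  (∀ w' → w' ∉ B → Adj G u w' → Reach G (λ v → v ∉ B) w w' → w' ≡ w)

data PZFCompletes (G : Graph) : Subset (n G) → Set where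
  done  : ∀ {B} → (∀ v → v ∈ B) → PZFCompletes G B
  force : ∀ {B} u w → PForce G B u w → PZFCompletes G (B ∪ ⁅ w ⁆) → PZFCompletes G B

IsPZFSet : (G : Graph) → Subset (n G) → Set
IsPZFSet G B = PZFCompletes G B

ZplusIs : Graph → ℕ → Set
ZplusIs G z =
  (Σ (Subset (n G)) λ B → ∣ B ∣ ≡ z × IsPZFSet G B) ×
  (∀ B → IsPZFSet G B → z ≤ ∣ B ∣)

IsCycleIn : (G : Graph) → (Fin (n G) → Set) → List (Fin (n G)) → Set
IsCycleIn G P [] = ⊥
IsCycleIn G P (x ∷ xs) =
  3 ≤ length (x ∷ xs) × Unique (x ∷ xs) × All P (x ∷ xs) ×
  Linked (Adj G) (x ∷ xs) × LastAdj xs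
  where
    LastAdj : List (Fin (n G)) → Set
    LastAdj [] = Adj G x x
    LastAdj (y ∷ []) = Adj G y x
    LastAdj (y ∷ z ∷ zs) = LastAdj (z ∷ zs)

InducesTree : (G : Graph) → (Fin (n G) → Set) → Set
InducesTree G P =
  (∃ λ x → P x) ×
  (∀ x y → P x → P y → Reach G P x y) ×
  (∀ cyc → ¬ IsCycleIn G P cyc)

IsTreeCover : (G : Graph) → (t : ℕ) → (Fin (n G) → Fin t) → Set
IsTreeCover G t col = ∀ (i : Fin t) → InducesTree G (λ v → col v ≡ i)

TreeCoverNumberIs : Graph → ℕ → Set
TreeCoverNumberIs G t =
  (Σ (Fin (n G) → Fin t) λ col → IsTreeCover G t col) ×
  (∀ t' (col : Fin (n G) → Fin t') → IsTreeCover G t' col → t ≤ t')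

-- Initial clique H = K_{k+1} on Fin (suc k); m added vertices, the j-th
-- attached to the k-clique (k-subset of H) c j, and to nothing else.
-- Vertex set Fin (suc k + m): first suc k vertices are H.

ClAdj : (k m : ℕ) → (Fin m → Subset (suc k)) →
        Fin (suc k) ⊎ Fin m → Fin (suc k) ⊎ Fin m → Set
ClAdj k m c (inj₁ a) (inj₁ b) = a ≢ b
ClAdj k m c (inj₁ a) (inj₂ j) = a ∈ c j
ClAdj k m c (inj₂ j) (inj₁ a) = a ∈ c j
ClAdj k m c (inj₂ i) (inj₂ j) = ⊥

cluster : (k m : ℕ) → (Fin m → Subset (suc k)) → Graph
cluster k m c = record
  { n = suc k + m
  ; Adj = λ x y → ClAdj k m c (splitAt (suc k) x) (splitAt (suc k) y) }

hV : (k m : ℕ) → Fin (suc k) → Fin (suc k + m)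
hV k m a = join (suc k) m (inj₁ a)

nV : (k m : ℕ) → Fin m → Fin (suc k + m)
nV k m j = join (suc k) m (inj₂ j)

InS : (k m : ℕ) → (Fin m → Subset (suc k)) → Subset (suc k) → Set
InS k m c H' =
  ∣ H' ∣ ≡ k ×
  (∃ λ (j : Fin m) →
     (∀ a → a ∈ H' → Adj (cluster k m c) (hV k m a) (nV k m j)) ×
     (∀ a b → a ∈ H' → b ∈ H' → a ≢ b →
        Adj (cluster k m c) (hV k m a) (hV k m b)))

module Submission where

-- Every added vertex j of a k-cluster G is attached to all of the initial
-- clique H = K_{k+1} except exactly one vertex, its "missing vertex" p j.
-- Hence S(G) is the set of complements H ∖ {p j}, and |S(G)| is the number of
-- distinct missing vertices.
--
-- * Z₊ upper bounds: once H is black, each added vertex is the unique white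
--   neighbour of any of its neighbours in its own (singleton) white component.
--   With at most two missing vertices {q, y}, the set H ∖ {q} also works,
--   because y forces q first.
-- * Z₊ lower bounds: analysing the first force shows every positive zero
--   forcing set has at least k vertices; with three distinct missing vertices an
--   invariant, preserved backwards along a forcing sequence, gives k + 1.
-- * T lower bounds: an induced tree meets the clique H in at most two vertices,
--   so 2T ≥ k + 1; when every vertex of H is missing for some added vertex and
--   k is even, two "slots" must stay unused, so 2T ≥ k + 3.
-- * T upper bounds (k = 2r): split H into r edges plus one vertex a₀ that
--   carries the added vertices as a star; this works if no added vertex
--   misses a₀, and in general one extra star around another clique vertex
--   picks up the added vertices missing a₀.

open import Defs
open import Data.Nat using (ℕ; zero; suc; _+_; _*_; _∸_; _≤_; _<_; z≤n; s≤s; ⌈_/2⌉; ⌊_/2⌋)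
import Data.Nat.Properties as ℕₚ
open import Data.Nat.Divisibility using (_∣_; divides; ∣m+n∣m⇒∣n; ∣1⇒≡1)
open import Data.Fin using (Fin; zero; suc; fromℕ; inject₁; punchIn; punchOut; splitAt; join; combine; remQuot)
open import Data.Fin using (_↑ˡ_; _↑ʳ_)
import Data.Fin as Fin
import Data.Fin.Properties as Finₚ
open import Data.Fin.Subset using (Subset; inside; outside; _∈_; _∉_; _⊂_; ∣_∣; _∪_; ⁅_⁆; ∁; ⊤)
open import Data.Fin.Subset using () renaming (⊥ to ∅)
import Data.Fin.Subset.Properties as Subₚ
open import Data.Vec using (_∷_; []; _++_)
open import Data.Vec.Base using (here; there)
open import Data.List using (List; []; _∷_; length; lookup; allFin)
import Data.List.Membership.Propositional as List
open import Data.List.Membership.Propositional.Properties using (∈-lookup; ∈-allFin)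
open import Data.List.Relation.Unary.Any using (index; here; there)
open import Data.List.Relation.Unary.Any.Properties using (lookup-index)
open import Data.List.Relation.Unary.All using (_∷_; [])
open import Data.List.Relation.Unary.AllPairs using (_∷_; [])
open import Data.List.Relation.Unary.Linked using (_∷_; [-])
open import Data.List.Relation.Unary.Unique.Propositional using (Unique)
open import Data.List.Relation.Unary.Unique.Propositional.Properties using (Unique[x∷xs]⇒x∉xs)
open import Data.Bool using (Bool; true; false)
open import Data.Product using (Σ; ∃; _×_; _,_; proj₁; proj₂)
open import Data.Sum using (_⊎_; inj₁; inj₂; [_,_]′)
open import Data.Sum.Properties using (inj₁-injective; inj₂-injective; ≡-dec)
open import Data.Empty using (⊥; ⊥-elim)
open import Relation.Binary using (tri<; tri≈; tri>)
open import Relation.Binary.PropositionalEquality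
open import Relation.Nullary using (¬_; Dec; yes; no; ¬?; _×-dec_)
open import Relation.Nullary.Decidable using (isYes; decidable-stable)
open import Function.Bundles using (Equivalence)
open import Induction.WellFounded using (Acc; acc)
open import Data.Fin.Induction using (<-wellFounded)
import Data.Fin.Relation.Unary.Top as Top

injective-into-list : ∀ {A : Set} {N : ℕ} (xs : List A) (f : Fin N → A) →
  (∀ i → f i List.∈ xs) → (∀ i j → f i ≡ f j → i ≡ j) → N ≤ length xs
injective-into-list xs f mem inj = Finₚ.injective⇒≤ {f = λ i → index (mem i)} λ {i} {j} e →
  inj i j (trans (lookup-index (mem i)) (trans (cong (lookup xs) e) (sym (lookup-index (mem j)))))

lookup-injective : ∀ {A : Set} (xs : List A) → Unique xs → ∀ i j → lookup xs i ≡ lookup xs j → i ≡ j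
lookup-injective (x ∷ xs) u zero zero e = refl
lookup-injective (x ∷ xs) u zero (suc j) e =
  ⊥-elim (Unique[x∷xs]⇒x∉xs u (subst (List._∈ xs) (sym e) (∈-lookup j)))
lookup-injective (x ∷ xs) u (suc i) zero e =
  ⊥-elim (Unique[x∷xs]⇒x∉xs u (subst (List._∈ xs) e (∈-lookup i)))
lookup-injective (x ∷ xs) (_ ∷ u) (suc i) (suc j) e = cong suc (lookup-injective xs u i j e)

∣++∣ : ∀ {a b} (T : Subset a) (U : Subset b) → ∣ T ++ U ∣ ≡ ∣ T ∣ + ∣ U ∣
∣++∣ [] U = refl
∣++∣ (inside ∷ T) U = cong suc (∣++∣ T U)
∣++∣ (outside ∷ T) U = ∣++∣ T U

∈-++⁺ˡ : ∀ {a b} (T : Subset a) (U : Subset b) (x : Fin a) → x ∈ T → (x ↑ˡ b) ∈ T ++ U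
∈-++⁺ˡ (inside ∷ T) U zero here = here
∈-++⁺ˡ (_ ∷ T) U (suc x) (there x∈) = there (∈-++⁺ˡ T U x x∈)

∈-++⁻ˡ : ∀ {a b} (T : Subset a) (U : Subset b) (x : Fin a) → (x ↑ˡ b) ∈ T ++ U → x ∈ T
∈-++⁻ˡ (inside ∷ T) U zero here = here
∈-++⁻ˡ (_ ∷ T) U (suc x) (there x∈) = there (∈-++⁻ˡ T U x x∈)

∈-++⁻ʳ : ∀ {a b} (T : Subset a) (U : Subset b) (x : Fin b) → (a ↑ʳ x) ∈ T ++ U → x ∈ U
∈-++⁻ʳ [] U x x∈ = x∈
∈-++⁻ʳ (_ ∷ T) U x (there x∈) = ∈-++⁻ʳ T U x x∈

∣∪⁅⁆∣≤ : ∀ {a} (S : Subset a) (q : Fin a) → ∣ S ∪ ⁅ q ⁆ ∣ ≤ suc ∣ S ∣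
∣∪⁅⁆∣≤ (inside ∷ S) zero =
  s≤s (ℕₚ.m≤n⇒m≤1+n (ℕₚ.≤-reflexive (cong ∣_∣ (Subₚ.∪-identityʳ S))))
∣∪⁅⁆∣≤ (outside ∷ S) zero = s≤s (ℕₚ.≤-reflexive (cong ∣_∣ (Subₚ.∪-identityʳ S)))
∣∪⁅⁆∣≤ (inside ∷ S) (suc q) = s≤s (∣∪⁅⁆∣≤ S q)
∣∪⁅⁆∣≤ (outside ∷ S) (suc q) = ∣∪⁅⁆∣≤ S q

module _ {N : ℕ} {B : Subset N} where
  ∈-∪⁅⁆-old : ∀ {v w} → v ∈ B → v ∈ B ∪ ⁅ w ⁆
  ∈-∪⁅⁆-old v∈ = Subₚ.x∈p∪q⁺ (inj₁ v∈)

  ∈-∪⁅⁆-new : ∀ {w} → w ∈ B ∪ ⁅ w ⁆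
  ∈-∪⁅⁆-new {w} = Subₚ.x∈p∪q⁺ {p = B} (inj₂ (Subₚ.x∈⁅x⁆ w))

  ∈-∪⁅⁆⁻ : ∀ {v w} → v ∈ B ∪ ⁅ w ⁆ → v ≢ w → v ∈ B
  ∈-∪⁅⁆⁻ {v} {w} v∈ v≢w =
    [ (λ v∈B → v∈B) , (λ v∈w → ⊥-elim (v≢w (Subₚ.x∈⁅y⁆⇒x≡y w v∈w))) ]′
      (Subₚ.x∈p∪q⁻ B ⁅ w ⁆ v∈)

∈∁⁅⁆ : ∀ {N} {a z : Fin N} → z ≢ a → z ∈ ∁ ⁅ a ⁆
∈∁⁅⁆ {a = a} z≢a = Subₚ.x∉p⇒x∈∁p λ z∈ → z≢a (Subₚ.x∈⁅y⁆⇒x≡y a z∈)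

∉∁⁅⁆ : ∀ {N} (a : Fin N) → a ∉ ∁ ⁅ a ⁆
∉∁⁅⁆ a a∈ = Subₚ.x∈∁p⇒x∉p a∈ (Subₚ.x∈⁅x⁆ a)

∈∁⁅⁆⁻ : ∀ {N} {a z : Fin N} → z ∈ ∁ ⁅ a ⁆ → z ≢ a
∈∁⁅⁆⁻ {a = a} z∈ refl = ∉∁⁅⁆ a z∈

∣∁⁅⁆∣ : ∀ {k} (a : Fin (suc k)) → ∣ ∁ ⁅ a ⁆ ∣ ≡ k
∣∁⁅⁆∣ {k} a = trans (Subₚ.∣∁p∣≡n∸∣p∣ ⁅ a ⁆) (cong (suc k ∸_) (Subₚ.∣⁅x⁆∣≡1 a))

∁⁅⁆-injective : ∀ {N} {a b : Fin N} → ∁ ⁅ a ⁆ ≡ ∁ ⁅ b ⁆ → a ≡ b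
∁⁅⁆-injective {a = a} {b} e with a Finₚ.≟ b
... | yes a≡b = a≡b
... | no a≢b = ⊥-elim (∉∁⁅⁆ b (subst (b ∈_) e (∈∁⁅⁆ λ b≡a → a≢b (sym b≡a))))

module MissingElement {k : ℕ} (S : Subset (suc k)) (∣S∣≡k : ∣ S ∣ ≡ k) where
  missing : ∃ λ a → a ∉ S
  missing = Finₚ.¬∀⟶∃¬ (suc k) (_∈ S) (Subₚ._∈? S) λ all∈ →
    ℕₚ.<-irrefl refl (ℕₚ.≤-trans
      (subst (_≤ ∣ S ∣) (Subₚ.∣⊤∣≡n (suc k)) (Subₚ.p⊆q⇒∣p∣≤∣q∣ {p = ⊤} (λ {x} _ → all∈ x)))
      (ℕₚ.≤-reflexive ∣S∣≡k))

  missing-unique : ∀ a b → a ∉ S → b ∉ S → a ≡ b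
  missing-unique a b a∉ b∉ with a Finₚ.≟ b
  ... | yes a≡b = a≡b
  ... | no a≢b = ⊥-elim (ℕₚ.<-irrefl refl (ℕₚ.≤-trans S<∁a (ℕₚ.≤-reflexive (∣∁⁅⁆∣ a))))
    where
      S⊂∁a : S ⊂ ∁ ⁅ a ⁆
      S⊂∁a = (λ {x} x∈ → ∈∁⁅⁆ λ { refl → a∉ x∈ })
           , b , ∈∁⁅⁆ (λ b≡a → a≢b (sym b≡a)) , b∉
      S<∁a : suc k ≤ ∣ ∁ ⁅ a ⁆ ∣
      S<∁a = subst (_≤ ∣ ∁ ⁅ a ⁆ ∣) (cong suc ∣S∣≡k) (Subₚ.p⊂q⇒∣p∣<∣q∣ S⊂∁a)

  ∈-unless-missing : ∀ a z → a ∉ S → z ≢ a → z ∈ S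
  ∈-unless-missing a z a∉ z≢a with z Subₚ.∈? S
  ... | yes z∈ = z∈
  ... | no z∉ = ⊥-elim (z≢a (missing-unique z a z∉ a∉))

  ≡∁⁅missing⁆ : ∀ a → a ∉ S → S ≡ ∁ ⁅ a ⁆
  ≡∁⁅missing⁆ a a∉ = Subₚ.⊆-antisym
    (λ {x} x∈ → ∈∁⁅⁆ λ { refl → a∉ x∈ })
    (λ {x} x∈ → ∈-unless-missing a x a∉ (∈∁⁅⁆⁻ x∈))

⌈/2⌉≤ : ∀ n t → n ≤ t + t → ⌈ n /2⌉ ≤ t
⌈/2⌉≤ n t n≤2t = subst (⌈ n /2⌉ ≤_) (sym (ℕₚ.n≡⌈n+n/2⌉ t)) (ℕₚ.⌈n/2⌉-mono n≤2t)

⌈/2⌉+1≤ : ∀ n t → n + 2 ≤ t + t → ⌈ n /2⌉ + 1 ≤ t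
⌈/2⌉+1≤ n t n+2≤2t = begin
  ⌈ n /2⌉ + 1    ≡⟨ ℕₚ.+-comm ⌈ n /2⌉ 1 ⟩
  ⌈ 2 + n /2⌉    ≡⟨ cong ⌈_/2⌉ (ℕₚ.+-comm 2 n) ⟩
  ⌈ n + 2 /2⌉    ≤⟨ ⌈/2⌉≤ (n + 2) t n+2≤2t ⟩
  t              ∎
  where open ℕₚ.≤-Reasoning

⌊double/2⌋ : ∀ r → ⌊ r * 2 /2⌋ ≡ r
⌊double/2⌋ zero = refl
⌊double/2⌋ (suc r) = cong suc (⌊double/2⌋ r)

⌈odd/2⌉ : ∀ r → ⌈ suc (r * 2) /2⌉ ≡ suc r
⌈odd/2⌉ r = cong suc (⌊double/2⌋ r)

double≢suc-even : ∀ k t → 2 ∣ k → t + t ≢ suc k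
double≢suc-even k t 2∣k t+t≡1+k = case (∣1⇒≡1 (∣m+n∣m⇒∣n 2∣k+1 2∣k))
  where
    2∣k+1 : 2 ∣ k + 1
    2∣k+1 = divides t (begin
      k + 1       ≡⟨ ℕₚ.+-comm k 1 ⟩
      suc k       ≡⟨ sym t+t≡1+k ⟩
      t + t       ≡⟨ cong (t +_) (sym (ℕₚ.+-identityʳ t)) ⟩
      2 * t       ≡⟨ ℕₚ.*-comm 2 t ⟩
      t * 2       ∎)
      where open ≡-Reasoning
    case : 2 ≢ 1
    case ()

join-injective : ∀ a b {x y : Fin a ⊎ Fin b} → join a b x ≡ join a b y → x ≡ y
join-injective a b {x} {y} e =
  trans (sym (Finₚ.splitAt-join a b x)) (trans (cong (splitAt a) e) (Finₚ.splitAt-join a b y))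

injective-into-⊎ : ∀ {N a b} (f : Fin N → Fin a ⊎ Fin b) → (∀ i j → f i ≡ f j → i ≡ j) → N ≤ a + b
injective-into-⊎ {a = a} {b} f f-inj =
  Finₚ.injective⇒≤ {f = λ i → join a b (f i)} λ {i} {j} e → f-inj i j (join-injective a b e)

injective-missing-two : ∀ {N a b} (f : Fin N → Fin a ⊎ Fin b) → (∀ i j → f i ≡ f j → i ≡ j) →
  ∀ σ₁ σ₂ → σ₁ ≢ σ₂ → (∀ i → f i ≢ σ₁) → (∀ i → f i ≢ σ₂) → N + 2 ≤ a + b
injective-missing-two {N} f f-inj σ₁ σ₂ σ₁≢σ₂ miss₁ miss₂ =
  injective-into-⊎ (λ v → F (splitAt N v)) λ v w e →
    trans (sym (Finₚ.join-splitAt N 2 v))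
      (trans (cong (join N 2) (F-inj (splitAt N v) (splitAt N w) e)) (Finₚ.join-splitAt N 2 w))
  where
    F : Fin N ⊎ Fin 2 → _
    F (inj₁ i) = f i
    F (inj₂ zero) = σ₁
    F (inj₂ (suc zero)) = σ₂
    F-inj : ∀ x y → F x ≡ F y → x ≡ y
    F-inj (inj₁ i) (inj₁ j) e = cong inj₁ (f-inj i j e)
    F-inj (inj₁ i) (inj₂ zero) e = ⊥-elim (miss₁ i e)
    F-inj (inj₁ i) (inj₂ (suc zero)) e = ⊥-elim (miss₂ i e)
    F-inj (inj₂ zero) (inj₁ j) e = ⊥-elim (miss₁ j (sym e))
    F-inj (inj₂ (suc zero)) (inj₁ j) e = ⊥-elim (miss₂ j (sym e))
    F-inj (inj₂ zero) (inj₂ zero) e = refl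
    F-inj (inj₂ zero) (inj₂ (suc zero)) e = ⊥-elim (σ₁≢σ₂ e)
    F-inj (inj₂ (suc zero)) (inj₂ zero) e = ⊥-elim (σ₁≢σ₂ (sym e))
    F-inj (inj₂ (suc zero)) (inj₂ (suc zero)) e = refl

value-attained? : ∀ {N a b} (f : Fin N → Fin a ⊎ Fin b) (v : Fin (a + b)) → Dec (∃ λ i → f i ≡ splitAt a v)
value-attained? {a = a} f v = Finₚ.any? (λ i → ≡-dec Finₚ._≟_ Finₚ._≟_ (f i) (splitAt a v))

-- Pigeonhole, dual form: a map into a larger set misses some value
-- (otherwise choosing preimages would inject the target into the source).
misses-some-value : ∀ {N a b} → N < a + b → (f : Fin N → Fin a ⊎ Fin b) → ∃ λ σ → ∀ i → f i ≢ σ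
misses-some-value {N} {a} {b} N<a+b f with Finₚ.all? (value-attained? f)
... | yes all-hit = ⊥-elim (ℕₚ.<-irrefl refl (ℕₚ.<-≤-trans N<a+b
        (Finₚ.injective⇒≤ {f = λ v → proj₁ (all-hit v)} λ {v} {w} e →
          trans (sym (Finₚ.join-splitAt a b v))
            (trans (cong (join a b) (trans (sym (proj₂ (all-hit v))) (trans (cong f e) (proj₂ (all-hit w)))))
              (Finₚ.join-splitAt a b w)))))
... | no ¬all-hit with Finₚ.¬∀⟶∃¬ (a + b) _ (value-attained? f) ¬all-hit
...   | v , not-hit = splitAt a v , λ i e → not-hit (i , e)

reach-start : ∀ {G P x y} → Reach G P x y → P x
reach-start (here px) = px
reach-start (step px _ _) = px

reach-trans : ∀ {G P x y z} → Reach G P x y → Reach G P y z → Reach G P x z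
reach-trans (here _) r = r
reach-trans (step px x~y r₁) r = step px x~y (reach-trans r₁ r)

no-triangle : ∀ {G P} → InducesTree G P → ∀ {x y z} → x ≢ y → x ≢ z → y ≢ z →
              Adj G x y → Adj G y z → Adj G z x → P x → P y → P z → ⊥
no-triangle (_ , _ , acyclic) x≢y x≢z y≢z x~y y~z z~x px py pz = acyclic (_ ∷ _ ∷ _ ∷ [])
  ( s≤s (s≤s (s≤s z≤n)) , ((x≢y ∷ x≢z ∷ []) ∷ (y≢z ∷ []) ∷ [] ∷ [])
  , (px ∷ py ∷ pz ∷ []) , (x~y ∷ y~z ∷ [-]) , z~x )

-- A star is a tree: a centre adjacent to every leaf, no two leaves adjacent.
-- Every edge of a star contains the centre, so a cycle would repeat it.
star-tree : ∀ G → (∀ {x y} → Adj G x y → Adj G y x) → (P : Fin (n G) → Set) (centre : Fin (n G))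
  (Leaf : Fin (n G) → Set) → P centre → (∀ v → P v → v ≡ centre ⊎ Leaf v) →
  (∀ v → P v → Leaf v → Adj G v centre) → (∀ x y → Leaf x → Leaf y → ¬ Adj G x y) → InducesTree G P
star-tree G adj-sym P centre Leaf p-centre centre-or-leaf leaf~centre ¬leaf~leaf =
  (centre , p-centre) , connected , acyclic
  where
    to-centre : ∀ x → P x → Reach G P x centre
    to-centre x px with centre-or-leaf x px
    ... | inj₁ refl = here p-centre
    ... | inj₂ leaf = step px (leaf~centre x px leaf) (here p-centre)
    from-centre : ∀ y → P y → Reach G P centre y
    from-centre y py with centre-or-leaf y py
    ... | inj₁ refl = here p-centre
    ... | inj₂ leaf = step p-centre (adj-sym (leaf~centre y py leaf)) (here py)
    connected : ∀ x y → P x → P y → Reach G P x y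
    connected x y px py = reach-trans (to-centre x px) (from-centre y py)
    edge : ∀ x y → P x → P y → Adj G x y → x ≡ centre ⊎ y ≡ centre
    edge x y px py x~y with centre-or-leaf x px | centre-or-leaf y py
    ... | inj₁ e | _ = inj₁ e
    ... | inj₂ _ | inj₁ e = inj₂ e
    ... | inj₂ lx | inj₂ ly = ⊥-elim (¬leaf~leaf x y lx ly x~y)
    acyclic : ∀ cyc → ¬ IsCycleIn G P cyc
    acyclic [] ()
    acyclic (_ ∷ []) (s≤s () , _)
    acyclic (_ ∷ _ ∷ []) (s≤s (s≤s ()) , _)
    acyclic (x₀ ∷ x₁ ∷ x₂ ∷ []) (_ , ((n₀₁ ∷ n₀₂ ∷ []) ∷ (n₁₂ ∷ []) ∷ _) ,
                                (p₀ ∷ p₁ ∷ p₂ ∷ []) , (a₀₁ ∷ a₁₂ ∷ _) , a₂₀)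
      with edge x₀ x₁ p₀ p₁ a₀₁ | edge x₁ x₂ p₁ p₂ a₁₂ | edge x₂ x₀ p₂ p₀ a₂₀
    ... | inj₁ e₀ | inj₁ e₁ | _ = n₀₁ (trans e₀ (sym e₁))
    ... | inj₁ e₀ | inj₂ e₂ | _ = n₀₂ (trans e₀ (sym e₂))
    ... | inj₂ e₁ | _ | inj₁ e₂ = n₁₂ (trans e₁ (sym e₂))
    ... | inj₂ e₁ | _ | inj₂ e₀ = n₀₁ (trans e₀ (sym e₁))
    acyclic (x₀ ∷ x₁ ∷ x₂ ∷ x₃ ∷ _) (_ , ((n₀₁ ∷ n₀₂ ∷ _) ∷ (n₁₂ ∷ n₁₃ ∷ _) ∷ _) ,
                                    (p₀ ∷ p₁ ∷ p₂ ∷ p₃ ∷ _) , (a₀₁ ∷ a₁₂ ∷ a₂₃ ∷ _) , _)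
      with edge x₀ x₁ p₀ p₁ a₀₁ | edge x₁ x₂ p₁ p₂ a₁₂ | edge x₂ x₃ p₂ p₃ a₂₃
    ... | inj₁ e₀ | inj₁ e₁ | _ = n₀₁ (trans e₀ (sym e₁))
    ... | inj₁ e₀ | inj₂ e₂ | _ = n₀₂ (trans e₀ (sym e₂))
    ... | inj₂ e₁ | _ | inj₁ e₂ = n₁₂ (trans e₁ (sym e₂))
    ... | inj₂ e₁ | _ | inj₂ e₃ = n₁₃ (trans e₁ (sym e₃))

module Cluster (k m : ℕ) (c : Fin m → Subset (suc k)) (∣c∣≡k : ∀ j → ∣ c j ∣ ≡ k) where
  G : Graph
  G = cluster k m c

  V : Set
  V = Fin (suc k + m)

  h : Fin (suc k) → V
  h = hV k m

  nv : Fin m → V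
  nv = nV k m

  data View : V → Set where
    isH : ∀ a → View (h a)
    isN : ∀ j → View (nv j)

  view : ∀ v → View v
  view v = subst View (Finₚ.join-splitAt (suc k) m v) (view′ (splitAt (suc k) v))
    where
      view′ : (s : Fin (suc k) ⊎ Fin m) → View (join (suc k) m s)
      view′ (inj₁ a) = isH a
      view′ (inj₂ j) = isN j

  splitAt-h : ∀ a → splitAt (suc k) (h a) ≡ inj₁ a
  splitAt-h a = Finₚ.splitAt-join (suc k) m (inj₁ a)

  splitAt-nv : ∀ j → splitAt (suc k) (nv j) ≡ inj₂ j
  splitAt-nv j = Finₚ.splitAt-join (suc k) m (inj₂ j)

  h-injective : ∀ {a b} → h a ≡ h b → a ≡ b
  h-injective {a} {b} e = inj₁-injective (join-injective (suc k) m {inj₁ a} {inj₁ b} e)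

  nv-injective : ∀ {i j} → nv i ≡ nv j → i ≡ j
  nv-injective {i} {j} e = inj₂-injective (join-injective (suc k) m {inj₂ i} {inj₂ j} e)

  h≢nv : ∀ {a j} → h a ≢ nv j
  h≢nv {a} {j} e with join-injective (suc k) m {inj₁ a} {inj₂ j} e
  ... | ()

  private
    CA = ClAdj k m c

  adjHH⁻ : ∀ {a b} → Adj G (h a) (h b) → a ≢ b
  adjHH⁻ {a} {b} e = subst₂ CA (splitAt-h a) (splitAt-h b) e

  adjHH : ∀ {a b} → a ≢ b → Adj G (h a) (h b)
  adjHH {a} {b} e = subst₂ CA (sym (splitAt-h a)) (sym (splitAt-h b)) e

  adjHN⁻ : ∀ {a j} → Adj G (h a) (nv j) → a ∈ c j
  adjHN⁻ {a} {j} e = subst₂ CA (splitAt-h a) (splitAt-nv j) e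

  adjHN : ∀ {a j} → a ∈ c j → Adj G (h a) (nv j)
  adjHN {a} {j} e = subst₂ CA (sym (splitAt-h a)) (sym (splitAt-nv j)) e

  adjNH⁻ : ∀ {a j} → Adj G (nv j) (h a) → a ∈ c j
  adjNH⁻ {a} {j} e = subst₂ CA (splitAt-nv j) (splitAt-h a) e

  adjNH : ∀ {a j} → a ∈ c j → Adj G (nv j) (h a)
  adjNH {a} {j} e = subst₂ CA (sym (splitAt-nv j)) (sym (splitAt-h a)) e

  ¬adjNN : ∀ {i j} → ¬ Adj G (nv i) (nv j)
  ¬adjNN {i} {j} e = subst₂ CA (splitAt-nv i) (splitAt-nv j) e

  adj-sym : ∀ {x y} → Adj G x y → Adj G y x
  adj-sym {x} {y} e with view x | view y
  ... | isH a | isH b = adjHH (λ b≡a → adjHH⁻ {a} {b} e (sym b≡a))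
  ... | isH a | isN j = adjNH (adjHN⁻ {a} {j} e)
  ... | isN j | isH b = adjHN (adjNH⁻ {b} {j} e)
  ... | isN i | isN j = ⊥-elim (¬adjNN {i} {j} e)

  ¬adj-refl : ∀ v → ¬ Adj G v v
  ¬adj-refl v = go (view v)
    where
      go : ∀ {v} → View v → ¬ Adj G v v
      go (isH a) e = adjHH⁻ {a} {a} e refl
      go (isN j) e = ¬adjNN {j} {j} e

  p : Fin m → Fin (suc k)
  p j = proj₁ (MissingElement.missing (c j) (∣c∣≡k j))

  p∉ : ∀ j → p j ∉ c j
  p∉ j = proj₂ (MissingElement.missing (c j) (∣c∣≡k j))

  ∈c : ∀ j z → z ≢ p j → z ∈ c j
  ∈c j z z≢p = MissingElement.∈-unless-missing (c j) (∣c∣≡k j) (p j) z (p∉ j) z≢p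

  ∈S : ∀ j → InS k m c (∁ ⁅ p j ⁆)
  ∈S j = ∣∁⁅⁆∣ (p j) , j , (λ a a∈ → adjHN (∈c j a (∈∁⁅⁆⁻ a∈))) , λ a b _ _ a≢b → adjHH a≢b

  ∈S⁻ : ∀ H′ → InS k m c H′ → ∃ λ j → H′ ≡ ∁ ⁅ p j ⁆
  ∈S⁻ H′ (∣H′∣≡k , j , H′⊆c , _) =
    j , MissingElement.≡∁⁅missing⁆ H′ ∣H′∣≡k (p j) (λ pj∈ → p∉ j (adjHN⁻ (H′⊆c (p j) pj∈)))

  ThreeMissing : Set
  ThreeMissing = Σ (Fin m) λ j₁ → Σ (Fin m) λ j₂ → Σ (Fin m) λ j₃ →
    p j₁ ≢ p j₂ × p j₁ ≢ p j₃ × p j₂ ≢ p j₃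

  module SizeOfS (s : ℕ) (hs : HasSize (InS k m c) s) where
    private
      xs = proj₁ hs
      length≡s : length xs ≡ s
      length≡s = proj₁ (proj₂ hs)
      unique : Unique xs
      unique = proj₁ (proj₂ (proj₂ hs))
      member : ∀ x → InS k m c x → x List.∈ xs
      member x = Equivalence.to (proj₂ (proj₂ (proj₂ hs)) x)
      member⁻ : ∀ x → x List.∈ xs → InS k m c x
      member⁻ x = Equivalence.from (proj₂ (proj₂ (proj₂ hs)) x)

    missing-count≤s : ∀ {N} (g : Fin N → Fin (suc k)) → (∀ i i′ → g i ≡ g i′ → i ≡ i′) →
                      (∀ i → ∃ λ j → p j ≡ g i) → N ≤ s
    missing-count≤s g g-inj g-missing = subst (_ ≤_) length≡s (injective-into-list xs (λ i → ∁ ⁅ g i ⁆)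
      (λ i → member _ (subst (λ z → InS k m c (∁ ⁅ z ⁆)) (proj₂ (g-missing i)) (∈S (proj₁ (g-missing i)))))
      (λ i i′ e → g-inj i i′ (∁⁅⁆-injective e)))

    three-missing : 3 ≤ s → ThreeMissing
    three-missing 3≤s = go xs (subst (3 ≤_) (sym length≡s) 3≤s) unique (λ y → member⁻ y)
      where
        go : (ys : List (Subset (suc k))) → 3 ≤ length ys → Unique ys →
             (∀ y → y List.∈ ys → InS k m c y) → ThreeMissing
        go [] () _ _
        go (_ ∷ []) (s≤s ()) _ _
        go (_ ∷ _ ∷ []) (s≤s (s≤s ())) _ _
        go (y₁ ∷ y₂ ∷ y₃ ∷ _) _ ((y₁≢y₂ ∷ y₁≢y₃ ∷ _) ∷ (y₂≢y₃ ∷ _) ∷ _) ys⊆S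
          with ∈S⁻ y₁ (ys⊆S y₁ (here refl)) | ∈S⁻ y₂ (ys⊆S y₂ (there (here refl)))
             | ∈S⁻ y₃ (ys⊆S y₃ (there (there (here refl))))
        ... | j₁ , refl | j₂ , refl | j₃ , refl =
          j₁ , j₂ , j₃ , (λ e → y₁≢y₂ (cong (λ z → ∁ ⁅ z ⁆) e))
                       , (λ e → y₁≢y₃ (cong (λ z → ∁ ⁅ z ⁆) e))
                       , (λ e → y₂≢y₃ (cong (λ z → ∁ ⁅ z ⁆) e))

    ¬three-missing : s < 3 → ¬ ThreeMissing
    ¬three-missing s<3 (j₁ , j₂ , j₃ , n₁₂ , n₁₃ , n₂₃) =
      ℕₚ.<-irrefl refl (ℕₚ.≤-trans (s≤s (missing-count≤s g g-inj g-missing)) s<3)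
      where
        g : Fin 3 → Fin (suc k)
        g zero = p j₁
        g (suc zero) = p j₂
        g (suc (suc zero)) = p j₃
        g-inj : ∀ i i′ → g i ≡ g i′ → i ≡ i′
        g-inj zero zero e = refl
        g-inj zero (suc zero) e = ⊥-elim (n₁₂ e)
        g-inj zero (suc (suc zero)) e = ⊥-elim (n₁₃ e)
        g-inj (suc zero) zero e = ⊥-elim (n₁₂ (sym e))
        g-inj (suc zero) (suc zero) e = refl
        g-inj (suc zero) (suc (suc zero)) e = ⊥-elim (n₂₃ e)
        g-inj (suc (suc zero)) zero e = ⊥-elim (n₁₃ (sym e))
        g-inj (suc (suc zero)) (suc zero) e = ⊥-elim (n₂₃ (sym e))
        g-inj (suc (suc zero)) (suc (suc zero)) e = refl
        g-missing : ∀ i → ∃ λ j → p j ≡ g i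
        g-missing zero = j₁ , refl
        g-missing (suc zero) = j₂ , refl
        g-missing (suc (suc zero)) = j₃ , refl

    missed? : ∀ a → Dec (∃ λ j → p j ≡ a)
    missed? a = Finₚ.any? (λ j → p j Finₚ.≟ a)

    -- |S(G)| = k + 1: every vertex a of H is missing for some added vertex,
    -- since otherwise S(G) contains only the k complements ∁ ⁅ b ⁆ with b ≢ a.
    all-missed : s ≡ suc k → ∀ a → ∃ λ j → p j ≡ a
    all-missed s≡1+k a with missed? a
    ... | yes missed = missed
    ... | no ¬missed = ⊥-elim (ℕₚ.<-irrefl refl
          (subst (_≤ k) (trans length≡s s≡1+k) (Finₚ.injective⇒≤ {f = g} λ {i} {i′} → g-inj i i′)))
      where
        jOf : Fin (length xs) → Fin m
        jOf i = proj₁ (∈S⁻ (lookup xs i) (member⁻ _ (∈-lookup i)))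
        lookup≡ : ∀ i → lookup xs i ≡ ∁ ⁅ p (jOf i) ⁆
        lookup≡ i = proj₂ (∈S⁻ (lookup xs i) (member⁻ _ (∈-lookup i)))
        a≢p : ∀ i → a ≢ p (jOf i)
        a≢p i e = ¬missed (jOf i , sym e)
        g : Fin (length xs) → Fin k
        g i = punchOut (a≢p i)
        g-inj : ∀ i i′ → g i ≡ g i′ → i ≡ i′
        g-inj i i′ e = lookup-injective xs unique i i′ (trans (lookup≡ i)
          (trans (cong (λ z → ∁ ⁅ z ⁆) (Finₚ.punchOut-injective (a≢p i) (a≢p i′) e)) (sym (lookup≡ i′))))

    some-unmissed : s < suc k → ∃ λ a → ∀ j → p j ≢ a
    some-unmissed s<1+k with Finₚ.¬∀⟶∃¬ (suc k) (λ a → ∃ λ j → p j ≡ a) missed?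
      (λ all → ℕₚ.<-irrefl refl (ℕₚ.≤-trans (s≤s (missing-count≤s (λ a → a) (λ _ _ e → e) all)) s<1+k))
    ... | a , ¬missed = a , λ j e → ¬missed (j , e)

  black-count : (T : Subset (suc k)) (U : Subset m) (B : Subset (suc k + m)) →
                (∀ a → a ∈ T → h a ∈ B) → (∀ j → j ∈ U → nv j ∈ B) → ∣ T ∣ + ∣ U ∣ ≤ ∣ B ∣
  black-count T U B T⊆B U⊆B = subst (_≤ ∣ B ∣) (∣++∣ T U) (Subₚ.p⊆q⇒∣p∣≤∣q∣ (λ {v} → ⊆B (view v)))
    where
      ⊆B : ∀ {v} → View v → v ∈ T ++ U → v ∈ B
      ⊆B (isH a) v∈ = T⊆B a (∈-++⁻ˡ T U a v∈)
      ⊆B (isN j) v∈ = U⊆B j (∈-++⁻ʳ T U j v∈)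

  ⁅⁆⊆ : ∀ {B : Subset (suc k + m)} j → nv j ∈ B → ∀ j′ → j′ ∈ ⁅ j ⁆ → nv j′ ∈ B
  ⁅⁆⊆ {B} j nv∈ j′ j′∈ = subst (λ z → nv z ∈ B) (sym (Subₚ.x∈⁅y⁆⇒x≡y j j′∈)) nv∈

  ∁⁅⁆⊆ : ∀ {B : Subset (suc k + m)} x → (∀ z → z ≢ x → h z ∈ B) →
         ∀ a → a ∈ ∁ ⁅ x ⁆ → h a ∈ B
  ∁⁅⁆⊆ x H∖x⊆B a a∈ = H∖x⊆B a (∈∁⁅⁆⁻ a∈)

  ∅⊆ : ∀ {B : Subset (suc k + m)} j → j ∈ ∅ → nv j ∈ B
  ∅⊆ j j∈ = ⊥-elim (Subₚ.∉⊥ j∈)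

  all-H⇒≥1+k : ∀ B → (∀ z → h z ∈ B) → suc k ≤ ∣ B ∣
  all-H⇒≥1+k B H⊆B = subst (_≤ ∣ B ∣) count (black-count ⊤ ∅ B (λ a _ → H⊆B a) ∅⊆)
    where
      count : ∣ ⊤ {suc k} ∣ + ∣ ∅ {m} ∣ ≡ suc k
      count = trans (cong₂ _+_ (Subₚ.∣⊤∣≡n (suc k)) (Subₚ.∣⊥∣≡0 m)) (ℕₚ.+-identityʳ _)

  H-but-one⇒≥k : ∀ B x → (∀ z → z ≢ x → h z ∈ B) → k ≤ ∣ B ∣
  H-but-one⇒≥k B x H∖x⊆B = subst (_≤ ∣ B ∣) count (black-count (∁ ⁅ x ⁆) ∅ B (∁⁅⁆⊆ x H∖x⊆B) ∅⊆)
    where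
      count : ∣ ∁ ⁅ x ⁆ ∣ + ∣ ∅ {m} ∣ ≡ k
      count = trans (cong₂ _+_ (∣∁⁅⁆∣ x) (Subₚ.∣⊥∣≡0 m)) (ℕₚ.+-identityʳ _)

  H-but-one⇒≥1+k : ∀ B x j → (∀ z → z ≢ x → h z ∈ B) → nv j ∈ B → suc k ≤ ∣ B ∣
  H-but-one⇒≥1+k B x j H∖x⊆B nv∈ =
    subst (_≤ ∣ B ∣) count (black-count (∁ ⁅ x ⁆) ⁅ j ⁆ B (∁⁅⁆⊆ x H∖x⊆B) (⁅⁆⊆ j nv∈))
    where
      count : ∣ ∁ ⁅ x ⁆ ∣ + ∣ ⁅ j ⁆ ∣ ≡ suc k
      count = trans (cong₂ _+_ (∣∁⁅⁆∣ x) (Subₚ.∣⁅x⁆∣≡1 j)) (ℕₚ.+-comm k 1)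

  H∖⁅x,q⁆ : Fin (suc k) → Fin (suc k) → Subset (suc k)
  H∖⁅x,q⁆ x q = ∁ (⁅ x ⁆ ∪ ⁅ q ⁆)

  ∈H∖⁅x,q⁆⁻ : ∀ {x q a} → a ∈ H∖⁅x,q⁆ x q → a ≢ x × a ≢ q
  ∈H∖⁅x,q⁆⁻ {x} {q} a∈ =
      (λ { refl → Subₚ.x∈∁p⇒x∉p a∈ (Subₚ.x∈p∪q⁺ (inj₁ (Subₚ.x∈⁅x⁆ x))) })
    , (λ { refl → Subₚ.x∈∁p⇒x∉p a∈ (Subₚ.x∈p∪q⁺ (inj₂ (Subₚ.x∈⁅x⁆ q))) })

  ∣H∖⁅x,q⁆∣ : ∀ x q → k ≤ ∣ H∖⁅x,q⁆ x q ∣ + 1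
  ∣H∖⁅x,q⁆∣ x q = ℕₚ.≤-trans (k≤k+1∸2 k) (ℕₚ.+-monoˡ-≤ 1 (subst (suc k ∸ 2 ≤_)
      (sym (Subₚ.∣∁p∣≡n∸∣p∣ (⁅ x ⁆ ∪ ⁅ q ⁆)))
      (ℕₚ.∸-monoʳ-≤ (suc k) (ℕₚ.≤-trans (∣∪⁅⁆∣≤ ⁅ x ⁆ q) (s≤s (ℕₚ.≤-reflexive (Subₚ.∣⁅x⁆∣≡1 x)))))))
    where
      k≤k+1∸2 : ∀ k → k ≤ (suc k ∸ 2) + 1
      k≤k+1∸2 zero = z≤n
      k≤k+1∸2 (suc k) = ℕₚ.≤-reflexive (ℕₚ.+-comm 1 k)

  H∖⁅x,q⁆⊆ : ∀ {B : Subset (suc k + m)} x q → (∀ z → z ≢ x → z ≢ q → h z ∈ B) →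
              ∀ a → a ∈ H∖⁅x,q⁆ x q → h a ∈ B
  H∖⁅x,q⁆⊆ x q H∖xq⊆B a a∈ = H∖xq⊆B a (proj₁ (∈H∖⁅x,q⁆⁻ a∈)) (proj₂ (∈H∖⁅x,q⁆⁻ a∈))

  H-but-two⇒≥k : ∀ B x q j → (∀ z → z ≢ x → z ≢ q → h z ∈ B) → nv j ∈ B → k ≤ ∣ B ∣
  H-but-two⇒≥k B x q j H∖xq⊆B nv∈ = ℕₚ.≤-trans (∣H∖⁅x,q⁆∣ x q)
    (subst (λ n → ∣ H∖⁅x,q⁆ x q ∣ + n ≤ ∣ B ∣) (Subₚ.∣⁅x⁆∣≡1 j)
      (black-count (H∖⁅x,q⁆ x q) ⁅ j ⁆ B (H∖⁅x,q⁆⊆ x q H∖xq⊆B) (⁅⁆⊆ j nv∈)))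

  H-but-two⇒≥1+k : ∀ B x q j₁ j₂ → j₁ ≢ j₂ → (∀ z → z ≢ x → z ≢ q → h z ∈ B) →
                    nv j₁ ∈ B → nv j₂ ∈ B → suc k ≤ ∣ B ∣
  H-but-two⇒≥1+k B x q j₁ j₂ j₁≢j₂ H∖xq⊆B nv₁∈ nv₂∈ = begin
    suc k                                   ≤⟨ s≤s (∣H∖⁅x,q⁆∣ x q) ⟩
    suc (∣ H∖⁅x,q⁆ x q ∣ + 1)               ≡⟨ sym (ℕₚ.+-suc _ 1) ⟩
    ∣ H∖⁅x,q⁆ x q ∣ + 2                     ≤⟨ ℕₚ.+-monoʳ-≤ ∣ H∖⁅x,q⁆ x q ∣ two ⟩
    ∣ H∖⁅x,q⁆ x q ∣ + ∣ ⁅ j₁ ⁆ ∪ ⁅ j₂ ⁆ ∣    ≤⟨ black-count _ _ B (H∖⁅x,q⁆⊆ x q H∖xq⊆B) U⊆B ⟩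
    ∣ B ∣                                   ∎
    where
      open ℕₚ.≤-Reasoning
      two : 2 ≤ ∣ ⁅ j₁ ⁆ ∪ ⁅ j₂ ⁆ ∣
      two = subst (_< ∣ ⁅ j₁ ⁆ ∪ ⁅ j₂ ⁆ ∣) (Subₚ.∣⁅x⁆∣≡1 j₁) (Subₚ.p⊂q⇒∣p∣<∣q∣
        ( (λ z∈ → Subₚ.x∈p∪q⁺ (inj₁ z∈)) , j₂ , Subₚ.x∈p∪q⁺ (inj₂ (Subₚ.x∈⁅x⁆ j₂))
        , λ j₂∈ → j₁≢j₂ (sym (Subₚ.x∈⁅y⁆⇒x≡y j₁ j₂∈))))
      U⊆B : ∀ j → j ∈ ⁅ j₁ ⁆ ∪ ⁅ j₂ ⁆ → nv j ∈ B
      U⊆B j j∈ = [ ⁅⁆⊆ j₁ nv₁∈ j , ⁅⁆⊆ j₂ nv₂∈ j ]′ (Subₚ.x∈p∪q⁻ ⁅ j₁ ⁆ ⁅ j₂ ⁆ j∈)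

  -- Lower bounds for Z₊: what a single force reveals about the black set.

  forced-unique : ∀ {B u w w′} → PForce G B u w → w′ ∉ B → Adj G u w′ → Adj G w w′ → w′ ≡ w
  forced-unique (_ , w∉ , _ , unique) w′∉ u~w′ w~w′ = unique _ w′∉ u~w′ (step w∉ w~w′ (here w′∉))

  data ForcedIntoH (B : Subset (suc k + m)) (u : V) (x : Fin (suc k)) : Set where
    from-H     : ∀ y → u ≡ h y → (∀ z → z ≢ x → h z ∈ B) → ForcedIntoH B u x
    from-added : ∀ j → u ≡ nv j → (∀ z → z ≢ x → z ≢ p j → h z ∈ B) → ForcedIntoH B u x

  forcing-into-H : ∀ {B u x} → PForce G B u (h x) → ForcedIntoH B u x
  forcing-into-H {B} {u} {x} pf@(u∈ , _ , _ , _) = go (view u) u∈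
    where
      black : ∀ z → z ≢ x → (h z ∉ B → Adj G u (h z)) → h z ∈ B
      black z z≢x u~hz with h z Subₚ.∈? B
      ... | yes hz∈ = hz∈
      ... | no hz∉ = ⊥-elim (z≢x (h-injective
            (forced-unique pf hz∉ (u~hz hz∉) (adjHH (λ x≡z → z≢x (sym x≡z))))))
      go : View u → u ∈ B → ForcedIntoH B u x
      go (isH y) hy∈ = from-H y refl λ z z≢x →
        black z z≢x λ hz∉ → adjHH {y} {z} λ { refl → hz∉ hy∈ }
      go (isN j) _ = from-added j refl λ z z≢x z≢p →
        black z z≢x λ _ → adjNH (∈c j z z≢p)

  forcing-into-added : ∀ {B u j} → PForce G B u (nv j) → ∀ z → z ≢ p j → h z ∈ B
  forcing-into-added {B} {u} {j} pf@(u∈ , _ , u~nv , _) = go (view u) u∈ u~nv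
    where
      go : View u → u ∈ B → Adj G u (nv j) → ∀ z → z ≢ p j → h z ∈ B
      go (isN i) _ i~j = ⊥-elim (¬adjNN {i} {j} i~j)
      go (isH y) hy∈ _ z z≢p with h z Subₚ.∈? B
      ... | yes hz∈ = hz∈
      ... | no hz∉ = ⊥-elim (h≢nv (forced-unique pf hz∉
                       (adjHH {y} {z} λ { refl → hz∉ hy∈ }) (adjNH (∈c j z z≢p))))

  pzf-set≥k : ∀ {B} → PZFCompletes G B → k ≤ ∣ B ∣
  pzf-set≥k {B} (done all∈) = ℕₚ.m≤n⇒m≤1+n ℕₚ.≤-refl ⟨≤⟩ all-H⇒≥1+k B (λ z → all∈ (h z))
    where _⟨≤⟩_ = ℕₚ.≤-trans
  pzf-set≥k {B} (force u w pf _) = go (view w) pf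
    where
      go : ∀ {w} → View w → PForce G B u w → k ≤ ∣ B ∣
      go (isN j) pf = H-but-one⇒≥k B (p j) (forcing-into-added pf)
      go (isH x) pf with forcing-into-H pf
      ... | from-H _ _ H∖x⊆B = H-but-one⇒≥k B x H∖x⊆B
      ... | from-added j refl H∖xp⊆B = H-but-two⇒≥k B x (p j) j H∖xp⊆B (proj₁ pf)

  Active : Subset (suc k + m) → Fin m → Set
  Active B j = nv j ∈ B × ∃ λ z → z ∈ c j × h z ∉ B

  active-before : ∀ {B w j} → Active (B ∪ ⁅ w ⁆) j → nv j ≢ w → Active B j
  active-before (nv∈ , z , z∈ , hz∉) nv≢w =
    ∈-∪⁅⁆⁻ nv∈ nv≢w , z , z∈ , λ hz∈ → hz∉ (∈-∪⁅⁆-old hz∈)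

  -- The invariant behind the bound k + 1: B contains all of H, or H minus one
  -- vertex plus one active added vertex, or H minus two vertices plus two
  -- distinct active added vertices.
  data Large (B : Subset (suc k + m)) : Set where
    all-H     : (∀ z → h z ∈ B) → Large B
    H-but-one : ∀ x → (∀ z → z ≢ x → h z ∈ B) → ∀ j → Active B j → Large B
    H-but-two : ∀ x q → (∀ z → z ≢ x → z ≢ q → h z ∈ B) →
                ∀ j₁ j₂ → j₁ ≢ j₂ → Active B j₁ → Active B j₂ → Large B

  Large⇒≥1+k : ∀ {B} → Large B → suc k ≤ ∣ B ∣
  Large⇒≥1+k {B} (all-H H⊆B) = all-H⇒≥1+k B H⊆B
  Large⇒≥1+k {B} (H-but-one x H∖x⊆B j (nv∈ , _)) = H-but-one⇒≥1+k B x j H∖x⊆B nv∈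
  Large⇒≥1+k {B} (H-but-two x q H∖xq⊆B j₁ j₂ j₁≢j₂ (nv₁∈ , _) (nv₂∈ , _)) =
    H-but-two⇒≥1+k B x q j₁ j₂ j₁≢j₂ H∖xq⊆B nv₁∈ nv₂∈

  Large-before-added : ∀ {B u j} → PForce G B u (nv j) → Large (B ∪ ⁅ nv j ⁆) → Large B
  Large-before-added {B} {u} {j} pf = before
    where
      H⊆B : ∀ {z} → h z ∈ B ∪ ⁅ nv j ⁆ → h z ∈ B
      H⊆B hz∈ = ∈-∪⁅⁆⁻ hz∈ h≢nv
      -- nv j has no white clique neighbour once it is forced, so it is not active.
      active : ∀ {j′} → Active (B ∪ ⁅ nv j ⁆) j′ → Active B j′
      active {j′} a@(_ , z , z∈ , hz∉) = active-before a λ nv≡ → case (nv-injective nv≡)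
        where
          case : j′ ≡ j → ⊥
          case refl = hz∉ (∈-∪⁅⁆-old {w = nv j} (forcing-into-added pf z λ { refl → p∉ j z∈ }))
      before : Large (B ∪ ⁅ nv j ⁆) → Large B
      before (all-H H⊆B′) = all-H λ z → H⊆B (H⊆B′ z)
      before (H-but-one x H∖x⊆B′ j₁ a) = H-but-one x (λ z z≢x → H⊆B (H∖x⊆B′ z z≢x)) j₁ (active a)
      before (H-but-two x q H∖xq⊆B′ j₁ j₂ j₁≢j₂ a₁ a₂) =
        H-but-two x q (λ z z≢x z≢q → H⊆B (H∖xq⊆B′ z z≢x z≢q)) j₁ j₂ j₁≢j₂ (active a₁) (active a₂)

  avoid-two : ThreeMissing → ∀ x y → ∃ λ j → p j ≢ x × p j ≢ y
  avoid-two (j₁ , j₂ , j₃ , n₁₂ , n₁₃ , n₂₃) x y with p j₃ Finₚ.≟ x | p j₃ Finₚ.≟ y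
  ... | no p₃≢x | no p₃≢y = j₃ , p₃≢x , p₃≢y
  ... | yes refl | _ with p j₁ Finₚ.≟ y
  ...   | no p₁≢y = j₁ , n₁₃ , p₁≢y
  ...   | yes refl = j₂ , n₂₃ , (λ e → n₁₂ (sym e))
  avoid-two (j₁ , j₂ , j₃ , n₁₂ , n₁₃ , n₂₃) x y | no _ | yes refl with p j₁ Finₚ.≟ x
  ...   | no p₁≢x = j₁ , p₁≢x , n₁₃
  ...   | yes refl = j₂ , (λ e → n₁₂ (sym e)) , n₂₃

  Large-before-H : ThreeMissing → ∀ {B u x} → PForce G B u (h x) → Large (B ∪ ⁅ h x ⁆) → Large B
  Large-before-H three {B} {u} {x} pf@(u∈ , hx∉ , u~hx , _) = before (forcing-into-H pf)
    where
      H⊆B : ∀ {z} → h z ∈ B ∪ ⁅ h x ⁆ → z ≢ x → h z ∈ B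
      H⊆B hz∈ z≢x = ∈-∪⁅⁆⁻ hz∈ (λ e → z≢x (h-injective e))
      active : ∀ {j} → Active (B ∪ ⁅ h x ⁆) j → Active B j
      active a = active-before a (λ e → h≢nv (sym e))
      forcer-active : ∀ {j} → u ≡ nv j → Active B j
      forcer-active refl = u∈ , x , adjNH⁻ u~hx , hx∉
      before : ForcedIntoH B u x → Large (B ∪ ⁅ h x ⁆) → Large B
      before (from-added j u≡j _) (all-H H⊆B′) =
        H-but-one x (λ z z≢x → H⊆B (H⊆B′ z) z≢x) j (forcer-active u≡j)
      -- A clique vertex h y forced h x: an added vertex nv j missing neither x
      -- nor y is adjacent to both, so it cannot be white; it is active.
      before (from-H y refl H∖x⊆B) (all-H _) with avoid-two three x y
      ... | j , pj≢x , pj≢y with nv j Subₚ.∈? B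
      ...   | yes nv∈ = H-but-one x H∖x⊆B j (nv∈ , x , ∈c j x (λ e → pj≢x (sym e)) , hx∉)
      ...   | no nv∉ = ⊥-elim (h≢nv (sym (forced-unique pf nv∉
                (adjHN (∈c j y (λ e → pj≢y (sym e)))) (adjHN (∈c j x (λ e → pj≢x (sym e)))))))
      before (from-H _ _ H∖x⊆B) (H-but-one _ _ j a) = H-but-one x H∖x⊆B j (active a)
      -- nv j forced h x while nv j₁ was active: j₁ ≠ j, since otherwise nv j
      -- would have a second white neighbour adjacent to h x.
      before (from-added j u≡j _) (H-but-one x′ H∖x′⊆B′ j₁ a) with j Finₚ.≟ j₁
      ... | no j≢j₁ = H-but-two x′ x (λ z z≢x′ z≢x → H⊆B (H∖x′⊆B′ z z≢x′) z≢x)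
                        j j₁ j≢j₁ (forcer-active u≡j) (active a)
      ... | yes refl with a | u≡j
      ...   | (_ , z , z∈ , hz∉) | refl = ⊥-elim (z≢x (h-injective
                (forced-unique pf (λ hz∈ → hz∉ (∈-∪⁅⁆-old hz∈)) (adjNH z∈)
                  (adjHH {x} {z} λ e → z≢x (sym e)))))
        where
          z≢x : z ≢ x
          z≢x refl = hz∉ ∈-∪⁅⁆-new
      before (from-H _ _ H∖x⊆B) (H-but-two _ _ _ j₁ _ _ a₁ _) = H-but-one x H∖x⊆B j₁ (active a₁)
      before (from-added j _ H∖xp⊆B) (H-but-two _ _ _ j₁ j₂ j₁≢j₂ a₁ a₂) =
        H-but-two x (p j) H∖xp⊆B j₁ j₂ j₁≢j₂ (active a₁) (active a₂)

  -- With three distinct missing vertices every positive zero forcing set has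
  -- at least k + 1 vertices: the final (all black) set is Large.
  pzf-set≥1+k : ThreeMissing → ∀ {B} → PZFCompletes G B → suc k ≤ ∣ B ∣
  pzf-set≥1+k three pz = Large⇒≥1+k (large pz)
    where
      large : ∀ {B} → PZFCompletes G B → Large B
      large (done all∈) = all-H (λ z → all∈ (h z))
      large {B} (force u w pf rest) = before (view w) pf (large rest)
        where
          before : ∀ {w} → View w → PForce G B u w → Large (B ∪ ⁅ w ⁆) → Large B
          before (isH x) = Large-before-H three
          before (isN j) = Large-before-added

  -- Upper bounds for Z₊: explicit positive zero forcing sets.

  isolated : ∀ {B j w′} → (∀ z → h z ∈ B) → Reach G (_∉ B) (nv j) w′ → w′ ≡ nv j
  isolated H⊆B (here _) = refl
  isolated {B} {j} H⊆B (step _ nv~y r) = go (view _) nv~y (reach-start r)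
    where
      go : ∀ {y} → View y → Adj G (nv j) y → y ∉ B → _
      go (isH a) _ ha∉ = ⊥-elim (ha∉ (H⊆B a))
      go (isN i) nv~nv _ = ⊥-elim (¬adjNN {j} {i} nv~nv)

  another-vertex : 1 ≤ k → (a : Fin (suc k)) → ∃ λ b → b ≢ a
  another-vertex 1≤k a = go k 1≤k a
    where
      go : ∀ k′ → 1 ≤ k′ → (a : Fin (suc k′)) → ∃ λ b → b ≢ a
      go (suc k′) _ zero = suc zero , λ ()
      go (suc k′) _ (suc a) = zero , λ ()

  -- If all of H is black, each white added vertex is forced by any of its
  -- clique neighbours; the added vertices are treated one after another.
  H-black⇒pzf : 1 ≤ k → ∀ B → (∀ z → h z ∈ B) → PZFCompletes G B
  H-black⇒pzf 1≤k B H⊆B = go (allFin m) B H⊆B λ j j∉ → ⊥-elim (j∉ (∈-allFin j))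
    where
      go : (js : List (Fin m)) → ∀ B → (∀ z → h z ∈ B) → (∀ j → ¬ j List.∈ js → nv j ∈ B) →
           PZFCompletes G B
      go [] B H⊆B rest = done λ v → black (view v)
        where
          black : ∀ {v} → View v → v ∈ B
          black (isH a) = H⊆B a
          black (isN j) = rest j λ ()
      go (j ∷ js) B H⊆B rest with nv j Subₚ.∈? B
      ... | yes nv∈ = go js B H⊆B λ j′ j′∉ →
                        [ (λ { refl → nv∈ }) , (λ nv′∈ → nv′∈) ]′ (j-or-rest j′ j′∉)
        where
          j-or-rest : ∀ j′ → ¬ j′ List.∈ js → j′ ≡ j ⊎ nv j′ ∈ B
          j-or-rest j′ j′∉ with j′ Finₚ.≟ j
          ... | yes j′≡j = inj₁ j′≡j
          ... | no j′≢j = inj₂ (rest j′ λ { (here e) → j′≢j e ; (there j′∈) → j′∉ j′∈ })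
      ... | no nv∉ = force (h y) (nv j) (H⊆B y , nv∉ , adjHN (∈c j y y≢p) , λ _ _ _ r → isolated H⊆B r)
                       (go js (B ∪ ⁅ nv j ⁆) (λ z → ∈-∪⁅⁆-old {w = nv j} (H⊆B z)) rest′)
        where
          y = proj₁ (another-vertex 1≤k (p j))
          y≢p = proj₂ (another-vertex 1≤k (p j))
          rest′ : ∀ j′ → ¬ j′ List.∈ js → nv j′ ∈ B ∪ ⁅ nv j ⁆
          rest′ j′ j′∉ with j′ Finₚ.≟ j
          ... | yes refl = ∈-∪⁅⁆-new
          ... | no j′≢j = ∈-∪⁅⁆-old {w = nv j} (rest j′ λ { (here e) → j′≢j e ; (there j′∈) → j′∉ j′∈ })

  Z₊≡1+k : 1 ≤ k → ThreeMissing → ZplusIs G (suc k)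
  Z₊≡1+k 1≤k three =
    (H-set , ∣H-set∣ , H-black⇒pzf 1≤k H-set (λ z → ∈-++⁺ˡ ⊤ ∅ z Subₚ.∈⊤)) ,
    λ B pz → pzf-set≥1+k three pz
    where
      H-set : Subset (suc k + m)
      H-set = ⊤ {suc k} ++ ∅ {m}
      ∣H-set∣ : ∣ H-set ∣ ≡ suc k
      ∣H-set∣ = trans (∣++∣ (⊤ {suc k}) (∅ {m}))
        (trans (cong₂ _+_ (Subₚ.∣⊤∣≡n (suc k)) (Subₚ.∣⊥∣≡0 m)) (ℕₚ.+-identityʳ _))

  TwoCover : Set
  TwoCover = Σ (Fin (suc k)) λ q → Σ (Fin (suc k)) λ y → y ≢ q × (∀ j → p j ≡ q ⊎ p j ≡ y)

  two-cover : 1 ≤ k → ¬ ThreeMissing → TwoCover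
  two-cover 1≤k ¬three with Finₚ.any? {n = m} {P = λ _ → Fin m} (λ j → yes j)
  ... | no no-added = zero , proj₁ (another-vertex 1≤k zero) , proj₂ (another-vertex 1≤k zero) ,
                      λ j → ⊥-elim (no-added (j , j))
  ... | yes (j₀ , _) with Finₚ.any? (λ j → ¬? (p j Finₚ.≟ p j₀))
  ...   | no one = p j₀ , proj₁ (another-vertex 1≤k (p j₀)) , proj₂ (another-vertex 1≤k (p j₀)) ,
                   λ j → inj₁ (decidable-stable (p j Finₚ.≟ p j₀) (λ pj≢p₀ → one (j , pj≢p₀)))
  ...   | yes (j₁ , p₁≢p₀) = p j₀ , p j₁ , p₁≢p₀ , two
    where
      two : ∀ j → p j ≡ p j₀ ⊎ p j ≡ p j₁
      two j with p j Finₚ.≟ p j₀ | p j Finₚ.≟ p j₁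
      ... | yes e | _ = inj₁ e
      ... | no _ | yes e = inj₂ e
      ... | no pj≢p₀ | no pj≢p₁ = ⊥-elim (¬three (j₀ , j₁ , j , (λ e → p₁≢p₀ (sym e)) ,
                                          (λ e → pj≢p₀ (sym e)) , (λ e → pj≢p₁ (sym e))))

  -- Z₊(G) = k otherwise: from H ∖ {q}, the vertex h y forces h q (the white
  -- component of h q holds only h q and added vertices missing y), and then
  -- all of H is black.
  Z₊≡k : 1 ≤ k → ¬ ThreeMissing → ZplusIs G k
  Z₊≡k 1≤k ¬three with two-cover 1≤k ¬three
  ... | q , y , y≢q , p∈qy =
    (B₀ , ∣B₀∣ , force (h y) (h q) (hy∈ , hq∉ , adjHH y≢q , y-forces-q) (H-black⇒pzf 1≤k _ H⊆B₀′)) ,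
    λ B pz → pzf-set≥k pz
    where
      B₀ : Subset (suc k + m)
      B₀ = ∁ ⁅ q ⁆ ++ ∅
      ∣B₀∣ : ∣ B₀ ∣ ≡ k
      ∣B₀∣ = trans (∣++∣ (∁ ⁅ q ⁆) (∅ {m}))
               (trans (cong₂ _+_ (∣∁⁅⁆∣ q) (Subₚ.∣⊥∣≡0 m)) (ℕₚ.+-identityʳ _))
      hy∈ : h y ∈ B₀
      hy∈ = ∈-++⁺ˡ (∁ ⁅ q ⁆) ∅ y (∈∁⁅⁆ y≢q)
      hq∉ : h q ∉ B₀
      hq∉ hq∈ = ∉∁⁅⁆ q (∈-++⁻ˡ (∁ ⁅ q ⁆) ∅ q hq∈)
      white-H : ∀ a → h a ∉ B₀ → a ≡ q
      white-H a ha∉ with a Finₚ.≟ q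
      ... | yes a≡q = a≡q
      ... | no a≢q = ⊥-elim (ha∉ (∈-++⁺ˡ (∁ ⁅ q ⁆) ∅ a (∈∁⁅⁆ a≢q)))
      H⊆B₀′ : ∀ z → h z ∈ B₀ ∪ ⁅ h q ⁆
      H⊆B₀′ z with z Finₚ.≟ q
      ... | yes refl = ∈-∪⁅⁆-new
      ... | no z≢q = ∈-∪⁅⁆-old (∈-++⁺ˡ (∁ ⁅ q ⁆) ∅ z (∈∁⁅⁆ z≢q))
      InComponent : V → Set
      InComponent v = v ≡ h q ⊎ ∃ λ j → v ≡ nv j × p j ≢ q
      component : ∀ {x v} → InComponent x → Reach G (_∉ B₀) x v → InComponent v
      component inx (here _) = inx
      component inx (step _ x~y r) = component (next inx (view _) x~y (reach-start r)) r
        where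
          next : ∀ {x y} → InComponent x → View y → Adj G x y → y ∉ B₀ → InComponent y
          next (inj₁ refl) (isH a) hq~ha ha∉ with white-H a ha∉
          ... | refl = ⊥-elim (adjHH⁻ {q} {q} hq~ha refl)
          next (inj₁ refl) (isN j) hq~nv _ = inj₂ (j , refl , λ { refl → p∉ j (adjHN⁻ hq~nv) })
          next (inj₂ (j , refl , _)) (isH a) _ ha∉ = inj₁ (cong h (white-H a ha∉))
          next (inj₂ (j , refl , _)) (isN i) nv~nv _ = ⊥-elim (¬adjNN {j} {i} nv~nv)
      y-forces-q : ∀ w′ → w′ ∉ B₀ → Adj G (h y) w′ → Reach G (_∉ B₀) (h q) w′ → w′ ≡ h q
      y-forces-q w′ _ hy~w′ r = only-hq (view w′) hy~w′ (component (inj₁ refl) r)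
        where
          only-hq : ∀ {w′} → View w′ → Adj G (h y) w′ → InComponent w′ → w′ ≡ h q
          only-hq _ _ (inj₁ w′≡hq) = w′≡hq
          only-hq (isH a) _ (inj₂ (_ , e , _)) = ⊥-elim (h≢nv e)
          only-hq (isN j) hy~nv (inj₂ (j′ , e , pj′≢q)) with nv-injective e
          ... | refl with p∈qy j
          ...   | inj₁ pj≡q = ⊥-elim (pj′≢q pj≡q)
          ...   | inj₂ refl = ⊥-elim (p∉ j (adjHN⁻ hy~nv))

  -- Tree covers, lower bounds.  Fix a cover of G by t induced trees, the tree
  -- of vertex v being col v.
  module TreeCoverLowerBound (t : ℕ) (col : V → Fin t) (cover : IsTreeCover G t col) where
    colH : Fin (suc k) → Fin t
    colH a = col (h a)

    monochromatic-triangle : ∀ {x y z} → x ≢ y → x ≢ z → y ≢ z → Adj G x y → Adj G y z → Adj G z x →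
                             col x ≡ col y → col x ≡ col z → ⊥
    monochromatic-triangle {x} x≢y x≢z y≢z x~y y~z z~x cx≡cy cx≡cz =
      no-triangle (cover (col x)) x≢y x≢z y≢z x~y y~z z~x refl (sym cx≡cy) (sym cx≡cz)

    at-most-two : ∀ {a b d} → a Fin.< b → b Fin.< d → colH a ≡ colH b → colH b ≡ colH d → ⊥
    at-most-two {a} {b} {d} a<b b<d ca≡cb cb≡cd = monochromatic-triangle
      (λ e → Finₚ.<-irrefl (h-injective e) a<b) (λ e → Finₚ.<-irrefl (h-injective e) a<d)
      (λ e → Finₚ.<-irrefl (h-injective e) b<d)
      (adjHH (Finₚ.<⇒≢ a<b)) (adjHH (Finₚ.<⇒≢ b<d)) (adjHH (λ e → Finₚ.<⇒≢ a<d (sym e)))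
      ca≡cb (trans ca≡cb cb≡cd)
      where
        a<d : a Fin.< d
        a<d = Finₚ.<-trans a<b b<d

    -- The slot of a clique vertex a: its tree, and whether an earlier clique
    -- vertex lies in the same tree (first slot inj₁, second slot inj₂).
    Repeated : Fin (suc k) → Set
    Repeated a = ∃ λ b → b Fin.< a × colH b ≡ colH a

    repeated? : ∀ a → Dec (Repeated a)
    repeated? a = Finₚ.any? (λ b → (b Finₚ.<? a) ×-dec (colH b Finₚ.≟ colH a))

    Slot : Set
    Slot = Fin t ⊎ Fin t

    mark : Bool → Fin t → Slot
    mark false = inj₁
    mark true = inj₂

    slot : Fin (suc k) → Slot
    slot a = mark (isYes (repeated? a)) (colH a)

    slot-first : ∀ a → ¬ Repeated a → slot a ≡ inj₁ (colH a)
    slot-first a ¬rep with repeated? a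
    ... | yes rep = ⊥-elim (¬rep rep)
    ... | no _ = refl

    slot-second : ∀ a → Repeated a → slot a ≡ inj₂ (colH a)
    slot-second a rep with repeated? a
    ... | yes _ = refl
    ... | no ¬rep = ⊥-elim (¬rep rep)

    slot-first⁻ : ∀ {a i} → slot a ≡ inj₁ i → ¬ Repeated a × colH a ≡ i
    slot-first⁻ {a} e with repeated? a
    ... | no ¬rep = ¬rep , inj₁-injective e

    slot-second⁻ : ∀ {a i} → slot a ≡ inj₂ i → Repeated a × colH a ≡ i
    slot-second⁻ {a} e with repeated? a
    ... | yes rep = rep , inj₂-injective e

    -- Two clique vertices a < b in the same slot would make b repeated and a
    -- repeated as well, giving three clique vertices in one tree.
    earlier-slot-differs : ∀ {a b} → a Fin.< b → slot a ≢ slot b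
    earlier-slot-differs {a} {b} a<b e with repeated? b
    ... | no ¬rep-b = ¬rep-b (a , a<b , proj₂ (slot-first⁻ e))
    ... | yes _ with slot-second⁻ e
    ...   | (a′ , a′<a , ca′≡ca) , ca≡cb = at-most-two a′<a a<b ca′≡ca ca≡cb

    slot-injective : ∀ a b → slot a ≡ slot b → a ≡ b
    slot-injective a b e with Finₚ.<-cmp a b
    ... | tri≈ _ a≡b _ = a≡b
    ... | tri< a<b _ _ = ⊥-elim (earlier-slot-differs a<b e)
    ... | tri> _ _ b<a = ⊥-elim (earlier-slot-differs b<a (sym e))

    2t≥1+k : suc k ≤ t + t
    2t≥1+k = injective-into-⊎ slot slot-injective

    Missed : Slot → Set
    Missed σ = ∀ a → slot a ≢ σ

    -- The least clique vertex of a tree takes its first slot; so if the first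
    -- slot of tree i is missed, tree i contains no clique vertex at all.
    first-missed⇒no-clique-vertex : ∀ i → Missed (inj₁ i) → ∀ a → colH a ≢ i
    first-missed⇒no-clique-vertex i missed a = go a (<-wellFounded a)
      where
        go : ∀ a → Acc Fin._<_ a → colH a ≢ i
        go a (acc smaller) ca≡i with repeated? a
        ... | no ¬rep = missed a (trans (slot-first a ¬rep) (cong inj₁ ca≡i))
        ... | yes (b , b<a , cb≡ca) = go b (smaller b<a) (trans cb≡ca ca≡i)

    only-clique-vertex : ∀ {i a} → Missed (inj₂ i) → slot a ≡ inj₁ i → ∀ a′ → colH a′ ≡ i → a′ ≡ a
    only-clique-vertex {i} {a} missed sa a′ ca′≡i with slot-first⁻ sa | Finₚ.<-cmp a a′
    ... | _ , _ | tri≈ _ a≡a′ _ = sym a≡a′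
    ... | _ , ca≡i | tri< a<a′ _ _ =
      ⊥-elim (missed a′ (trans (slot-second a′ (a , a<a′ , trans ca≡i (sym ca′≡i))) (cong inj₂ ca′≡i)))
    ... | ¬rep-a , ca≡i | tri> _ _ a′<a = ⊥-elim (¬rep-a (a′ , a′<a , trans ca′≡i (sym ca≡i)))

    -- An added vertex nv j cannot share a tree with h (p j) when h (p j) is the
    -- only clique vertex of that tree: its neighbours in the tree would all be
    -- clique vertices other than h (p j).
    added-leaves-tree : ∀ {i j} → (∀ a′ → colH a′ ≡ i → a′ ≡ p j) → colH (p j) ≡ i → col (nv j) ≢ i
    added-leaves-tree {i} {j} only cp≡i cnv≡i =
      first-step (proj₁ (proj₂ (cover i)) (nv j) (h (p j)) cnv≡i cp≡i) refl refl
      where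
        first-step : ∀ {x y} → Reach G (λ v → col v ≡ i) x y → x ≡ nv j → y ≡ h (p j) → ⊥
        first-step (here _) x≡nv y≡h = h≢nv (trans (sym y≡h) x≡nv)
        first-step (step _ x~y′ r) refl _ = neighbour (view _) x~y′ (reach-start r)
          where
            neighbour : ∀ {y′} → View y′ → Adj G (nv j) y′ → col y′ ≡ i → ⊥
            neighbour (isH b) nv~hb cb≡i with only b cb≡i
            ... | refl = p∉ j (adjNH⁻ nv~hb)
            neighbour (isN j′) nv~nv _ = ¬adjNN {j} {j′} nv~nv

    -- If nv j lies in a different tree from h (p j), the second slot of its
    -- tree is missed: two clique vertices there would both be neighbours of nv j.
    second-slot-of-added-missed : ∀ j → colH (p j) ≢ col (nv j) → Missed (inj₂ (col (nv j)))
    second-slot-of-added-missed j cp≢cnv b₂ sb₂ with slot-second⁻ sb₂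
    ... | (b₁ , b₁<b₂ , cb₁≡cb₂) , cb₂≡cnv = monochromatic-triangle
      (λ e → h≢nv (sym e)) (λ e → h≢nv (sym e)) (λ e → Finₚ.<-irrefl (h-injective e) b₁<b₂)
      (adjNH (∈c j b₁ (not-p (trans cb₁≡cb₂ cb₂≡cnv)))) (adjHH (Finₚ.<⇒≢ b₁<b₂))
      (adjHN (∈c j b₂ (not-p cb₂≡cnv)))
      (sym (trans cb₁≡cb₂ cb₂≡cnv)) (sym cb₂≡cnv)
      where
        not-p : ∀ {b} → colH b ≡ col (nv j) → b ≢ p j
        not-p cb≡cnv refl = cp≢cnv cb≡cnv

    TwoMissed : Set
    TwoMissed = Σ Slot λ σ₁ → Σ Slot λ σ₂ → σ₁ ≢ σ₂ × Missed σ₁ × Missed σ₂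

    another-missed : (∀ a → ∃ λ j → p j ≡ a) → ∀ σ → Missed σ → TwoMissed
    another-missed _ (inj₁ i) missed =
      inj₁ i , inj₂ i , (λ ()) , missed ,
      λ a sa → first-missed⇒no-clique-vertex i missed a (proj₂ (slot-second⁻ sa))
    another-missed all-missed (inj₂ i) missed
      with Finₚ.any? (λ a → ≡-dec Finₚ._≟_ Finₚ._≟_ (slot a) (inj₁ i))
    ... | no none = inj₁ i , inj₂ i , (λ ()) , (λ a sa → none (a , sa)) , missed
    ... | yes (a , sa) with all-missed a
    ...   | j , refl = inj₂ i , inj₂ (col (nv j)) , (λ e → cnv≢i (sym (inj₂-injective e))) , missed ,
                       second-slot-of-added-missed j (λ e → cnv≢i (trans (sym e) cp≡i))
      where
        cp≡i : colH (p j) ≡ i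
        cp≡i = proj₂ (slot-first⁻ sa)
        cnv≢i : col (nv j) ≢ i
        cnv≢i = added-leaves-tree (only-clique-vertex missed sa) cp≡i

    2t≥3+k : (∀ a → ∃ λ j → p j ≡ a) → t + t ≢ suc k → suc k + 2 ≤ t + t
    2t≥3+k all-missed 2t≢1+k with misses-some-value (ℕₚ.≤∧≢⇒< 2t≥1+k (λ e → 2t≢1+k (sym e))) slot
    ... | σ , missed with another-missed all-missed σ missed
    ...   | σ₁ , σ₂ , σ₁≢σ₂ , missed₁ , missed₂ =
      injective-missing-two slot slot-injective σ₁ σ₂ σ₁≢σ₂ missed₁ missed₂

-- Tree covers, upper bounds, for k = 2r.  Fix a clique vertex a₀ and pair up
-- the other 2r clique vertices as pt q 0, pt q 1 (q < r).  Colour 0 is the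
-- star centred at h a₀ whose leaves are the added vertices adjacent to it;
-- colour suc q is the edge {pt q 0, pt q 1}.
module EvenCluster (r m : ℕ) (c : Fin m → Subset (suc (r * 2))) (∣c∣≡k : ∀ j → ∣ c j ∣ ≡ r * 2)
                   (a₀ : Fin (suc (r * 2))) where
  open Cluster (r * 2) m c ∣c∣≡k

  pt : Fin r → Fin 2 → Fin (suc (r * 2))
  pt q e = punchIn a₀ (combine q e)

  pt≢a₀ : ∀ q e → pt q e ≢ a₀
  pt≢a₀ q e = Finₚ.punchInᵢ≢i a₀ (combine q e)

  pt-injective : ∀ q e q′ e′ → pt q e ≡ pt q′ e′ → q ≡ q′ × e ≡ e′
  pt-injective q e q′ e′ eq = Finₚ.combine-injective q e q′ e′ (Finₚ.punchIn-injective a₀ _ _ eq)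

  position : ∀ b → b ≢ a₀ → Fin r × Fin 2
  position b b≢a₀ = remQuot {r} 2 (punchOut (λ e → b≢a₀ (sym e)))

  position-pt : ∀ q e b≢a₀ → position (pt q e) b≢a₀ ≡ (q , e)
  position-pt q e _ = trans (cong (remQuot 2) (trans (Finₚ.punchOut-cong a₀ refl) (Finₚ.punchOut-punchIn a₀)))
                            (Finₚ.remQuot-combine q e)

  pt-position : ∀ b b≢a₀ → pt (proj₁ (position b b≢a₀)) (proj₂ (position b b≢a₀)) ≡ b
  pt-position b b≢a₀ = trans (cong (punchIn a₀) (Finₚ.combine-remQuot {r} 2 _)) (Finₚ.punchIn-punchOut _)

  pair-colour : Fin (suc (r * 2)) → Fin (suc r)
  pair-colour b with b Finₚ.≟ a₀
  ... | yes _ = zero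
  ... | no b≢a₀ = suc (proj₁ (position b b≢a₀))

  pair-colour-a₀ : pair-colour a₀ ≡ zero
  pair-colour-a₀ with a₀ Finₚ.≟ a₀
  ... | yes _ = refl
  ... | no a₀≢a₀ = ⊥-elim (a₀≢a₀ refl)

  pair-colour-pt : ∀ q e → pair-colour (pt q e) ≡ suc q
  pair-colour-pt q e with pt q e Finₚ.≟ a₀
  ... | yes pt≡a₀ = ⊥-elim (pt≢a₀ q e pt≡a₀)
  ... | no pt≢ = cong (λ z → suc (proj₁ z)) (position-pt q e pt≢)

  pair-colour-zero⁻ : ∀ b → pair-colour b ≡ zero → b ≡ a₀
  pair-colour-zero⁻ b e with b Finₚ.≟ a₀
  ... | yes b≡a₀ = b≡a₀
  pair-colour-zero⁻ b () | no _

  pair-colour-suc⁻ : ∀ b q → pair-colour b ≡ suc q → ∃ λ e → b ≡ pt q e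
  pair-colour-suc⁻ b q e with b Finₚ.≟ a₀
  pair-colour-suc⁻ b q () | yes _
  ... | no b≢a₀ = proj₂ (position b b≢a₀) ,
                  trans (sym (pt-position b b≢a₀))
                        (cong (λ z → pt z (proj₂ (position b b≢a₀))) (Finₚ.suc-injective e))

  pair-tree : (P : V → Set) (q : Fin r) → P (h (pt q zero)) → (∀ v → P v → ∃ λ e → v ≡ h (pt q e)) →
              InducesTree G P
  pair-tree P q p-centre in-pair =
    star-tree G (λ {x} {y} → adj-sym {x} {y}) P (h (pt q zero)) (_≡ h (pt q (suc zero))) p-centre
    centre-or-leaf (λ { v _ refl → adjHH (λ e → zero≢one (proj₂ (pt-injective q (suc zero) q zero e))) })
    (λ { x y refl refl → ¬adj-refl (h (pt q (suc zero))) })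
    where
      centre-or-leaf : ∀ v → P v → v ≡ h (pt q zero) ⊎ v ≡ h (pt q (suc zero))
      centre-or-leaf v pv with in-pair v pv
      ... | zero , e = inj₁ e
      ... | suc zero , e = inj₂ e
      zero≢one : Fin.suc {1} zero ≢ zero
      zero≢one ()

  added-star : (P : V → Set) (a : Fin (suc (r * 2))) → P (h a) →
               (∀ v → P v → v ≡ h a ⊎ ∃ λ j → v ≡ nv j × p j ≢ a) → InducesTree G P
  added-star P a p-centre centre-or-leaf =
    star-tree G (λ {x} {y} → adj-sym {x} {y}) P (h a) (λ v → ∃ λ j → v ≡ nv j × p j ≢ a)
    p-centre centre-or-leaf (λ { v _ (j , refl , pj≢a) → adjNH (∈c j a (λ e → pj≢a (sym e))) })
    (λ { x y (i , refl , _) (j , refl , _) → ¬adjNN {i} {j} })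

  module A₀Universal (a₀-universal : ∀ j → p j ≢ a₀) where
    col : V → Fin (suc r)
    col v = [ pair-colour , (λ _ → zero) ]′ (splitAt (suc (r * 2)) v)

    col-h : ∀ b → col (h b) ≡ pair-colour b
    col-h b = cong [ pair-colour , (λ _ → zero) ]′ (splitAt-h b)

    col-nv : ∀ j → col (nv j) ≡ zero
    col-nv j = cong [ pair-colour , (λ _ → zero) ]′ (splitAt-nv j)

    cover : IsTreeCover G (suc r) col
    cover zero = added-star _ a₀ (trans (col-h a₀) pair-colour-a₀) in-star
      where
        in-star : ∀ v → col v ≡ zero → v ≡ h a₀ ⊎ ∃ λ j → v ≡ nv j × p j ≢ a₀
        in-star v cv with view v
        ... | isH b = inj₁ (cong h (pair-colour-zero⁻ b (trans (sym (col-h b)) cv)))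
        ... | isN j = inj₂ (j , refl , a₀-universal j)
    cover (suc q) = pair-tree _ q (trans (col-h (pt q zero)) (pair-colour-pt q zero)) in-pair
      where
        in-pair : ∀ v → col v ≡ suc q → ∃ λ e → v ≡ h (pt q e)
        in-pair v cv with view v
        ... | isH b = let (e , b≡pt) = pair-colour-suc⁻ b q (trans (sym (col-h b)) cv) in e , cong h b≡pt
        ... | isN j with trans (sym (col-nv j)) cv
        ...   | ()

  -- In general (r ≥ 1), r + 2 trees suffice: the vertex y₁ = pt q₀ 1 leaves
  -- its pair and becomes the centre of a star of the added vertices missing a₀.
  module General (q₀ : Fin r) where
    y₁ : Fin (suc (r * 2))
    y₁ = pt q₀ (suc zero)

    y₁≢a₀ : y₁ ≢ a₀
    y₁≢a₀ = pt≢a₀ q₀ (suc zero)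

    last : Fin (suc (suc r))
    last = fromℕ (suc r)

    clique-colour : Fin (suc (r * 2)) → Fin (suc (suc r))
    clique-colour b with b Finₚ.≟ y₁
    ... | yes _ = last
    ... | no _ = inject₁ (pair-colour b)

    added-colour : Fin m → Fin (suc (suc r))
    added-colour j with p j Finₚ.≟ a₀
    ... | yes _ = last
    ... | no _ = inject₁ zero

    col : V → Fin (suc (suc r))
    col v = [ clique-colour , added-colour ]′ (splitAt (suc (r * 2)) v)

    col-h : ∀ b → col (h b) ≡ clique-colour b
    col-h b = cong [ clique-colour , added-colour ]′ (splitAt-h b)

    col-nv : ∀ j → col (nv j) ≡ added-colour j
    col-nv j = cong [ clique-colour , added-colour ]′ (splitAt-nv j)

    clique-colour-other : ∀ b → b ≢ y₁ → clique-colour b ≡ inject₁ (pair-colour b)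
    clique-colour-other b b≢y₁ with b Finₚ.≟ y₁
    ... | yes b≡y₁ = ⊥-elim (b≢y₁ b≡y₁)
    ... | no _ = refl

    clique-colour-last⁻ : ∀ b → clique-colour b ≡ last → b ≡ y₁
    clique-colour-last⁻ b e with b Finₚ.≟ y₁
    ... | yes b≡y₁ = b≡y₁
    ... | no _ = ⊥-elim (Finₚ.fromℕ≢inject₁ (sym e))

    added-colour-last⁻ : ∀ j → added-colour j ≡ last → p j ≡ a₀
    added-colour-last⁻ j e with p j Finₚ.≟ a₀
    ... | yes pj≡a₀ = pj≡a₀
    ... | no _ = ⊥-elim (Finₚ.fromℕ≢inject₁ (sym e))

    clique-colour-inject⁻ : ∀ b i → clique-colour b ≡ inject₁ i → pair-colour b ≡ i
    clique-colour-inject⁻ b i e with b Finₚ.≟ y₁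
    ... | yes _ = ⊥-elim (Finₚ.fromℕ≢inject₁ e)
    ... | no _ = Finₚ.inject₁-injective e

    added-colour-inject⁻ : ∀ j i → added-colour j ≡ inject₁ i → p j ≢ a₀ × zero ≡ i
    added-colour-inject⁻ j i e with p j Finₚ.≟ a₀
    ... | yes _ = ⊥-elim (Finₚ.fromℕ≢inject₁ e)
    ... | no pj≢a₀ = pj≢a₀ , Finₚ.inject₁-injective e

    cover-inject : ∀ i → InducesTree G (λ v → col v ≡ inject₁ i)
    cover-inject zero = added-star _ a₀
      (trans (col-h a₀) (trans (clique-colour-other a₀ (λ e → y₁≢a₀ (sym e))) (cong inject₁ pair-colour-a₀)))
      in-star
      where
        in-star : ∀ v → col v ≡ inject₁ zero → v ≡ h a₀ ⊎ ∃ λ j → v ≡ nv j × p j ≢ a₀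
        in-star v cv with view v
        ... | isH b = inj₁ (cong h (pair-colour-zero⁻ b (clique-colour-inject⁻ b zero (trans (sym (col-h b)) cv))))
        ... | isN j = inj₂ (j , refl , proj₁ (added-colour-inject⁻ j zero (trans (sym (col-nv j)) cv)))
    cover-inject (suc q) = pair-tree _ q
      (trans (col-h (pt q zero)) (trans (clique-colour-other (pt q zero) pt≢y₁) (cong inject₁ (pair-colour-pt q zero))))
      in-pair
      where
        pt≢y₁ : pt q zero ≢ y₁
        pt≢y₁ e with proj₂ (pt-injective q zero q₀ (suc zero) e)
        ... | ()
        in-pair : ∀ v → col v ≡ inject₁ (suc q) → ∃ λ e → v ≡ h (pt q e)
        in-pair v cv with view v
        ... | isH b = let (e , b≡pt) = pair-colour-suc⁻ b q (clique-colour-inject⁻ b (suc q) (trans (sym (col-h b)) cv))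
                      in e , cong h b≡pt
        ... | isN j with proj₂ (added-colour-inject⁻ j (suc q) (trans (sym (col-nv j)) cv))
        ...   | ()

    cover-last : InducesTree G (λ v → col v ≡ last)
    cover-last = added-star _ y₁ (trans (col-h y₁) y₁-last) in-star
      where
        y₁-last : clique-colour y₁ ≡ last
        y₁-last with y₁ Finₚ.≟ y₁
        ... | yes _ = refl
        ... | no y₁≢y₁ = ⊥-elim (y₁≢y₁ refl)
        in-star : ∀ v → col v ≡ last → v ≡ h y₁ ⊎ ∃ λ j → v ≡ nv j × p j ≢ y₁
        in-star v cv with view v
        ... | isH b = inj₁ (cong h (clique-colour-last⁻ b (trans (sym (col-h b)) cv)))
        ... | isN j = inj₂ (j , refl , λ e →
                        y₁≢a₀ (trans (sym e) (added-colour-last⁻ j (trans (sym (col-nv j)) cv))))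

    cover : IsTreeCover G (suc (suc r)) col
    cover i with Top.view i
    ... | Top.‵fromℕ = cover-last
    ... | Top.‵inject₁ i′ = cover-inject i′

TreeCover : Graph → ℕ → Set
TreeCover G t = Σ (Fin (n G) → Fin t) λ col → IsTreeCover G t col

cover-when-unmissed : ∀ k m (c : Fin m → Subset (suc k)) (∣c∣≡k : ∀ j → ∣ c j ∣ ≡ k) →
    2 ∣ k → (a₀ : Fin (suc k)) → (∀ j → Cluster.p k m c ∣c∣≡k j ≢ a₀) →
    TreeCover (cluster k m c) ⌈ suc k /2⌉
cover-when-unmissed k m c ∣c∣≡k (divides r refl) a₀ a₀-universal =
  subst (TreeCover (cluster k m c)) (sym (⌈odd/2⌉ r)) (col , cover)
  where open EvenCluster r m c ∣c∣≡k a₀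
        open A₀Universal a₀-universal

cover-general : ∀ k m (c : Fin m → Subset (suc k)) (∣c∣≡k : ∀ j → ∣ c j ∣ ≡ k) →
    1 ≤ k → 2 ∣ k → TreeCover (cluster k m c) (⌈ suc k /2⌉ + 1)
cover-general k m c ∣c∣≡k () (divides zero refl)
cover-general k m c ∣c∣≡k _ (divides (suc r) refl) =
  subst (TreeCover (cluster k m c)) (sym size) (col , cover)
  where
    open EvenCluster (suc r) m c ∣c∣≡k zero
    open General zero
    size : ⌈ suc (suc r * 2) /2⌉ + 1 ≡ suc (suc (suc r))
    size = trans (cong (_+ 1) (⌈odd/2⌉ (suc r))) (ℕₚ.+-comm (suc (suc r)) 1)

T≡⌈1+k/2⌉+1 : ∀ k m (c : Fin m → Subset (suc k)) (∣c∣≡k : ∀ j → ∣ c j ∣ ≡ k) →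
    1 ≤ k → 2 ∣ k → (∀ a → ∃ λ j → Cluster.p k m c ∣c∣≡k j ≡ a) →
    TreeCoverNumberIs (cluster k m c) (⌈ suc k /2⌉ + 1)
T≡⌈1+k/2⌉+1 k m c ∣c∣≡k 1≤k 2∣k all-missed = cover-general k m c ∣c∣≡k 1≤k 2∣k , λ t col cover →
  ⌈/2⌉+1≤ (suc k) t (TreeCoverLowerBound.2t≥3+k t col cover all-missed (double≢suc-even k t 2∣k))
  where open Cluster k m c ∣c∣≡k

T≡⌈1+k/2⌉ : ∀ k m (c : Fin m → Subset (suc k)) (∣c∣≡k : ∀ j → ∣ c j ∣ ≡ k) →
    2 ∣ k → (∃ λ a → ∀ j → Cluster.p k m c ∣c∣≡k j ≢ a) →
    TreeCoverNumberIs (cluster k m c) ⌈ suc k /2⌉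
T≡⌈1+k/2⌉ k m c ∣c∣≡k 2∣k (a₀ , a₀-universal) = cover-when-unmissed k m c ∣c∣≡k 2∣k a₀ a₀-universal ,
  λ t col cover → ⌈/2⌉≤ (suc k) t (TreeCoverLowerBound.2t≥1+k t col cover)
  where open Cluster k m c ∣c∣≡k

theorem9p1 : (k m : ℕ) (c : Fin m → Subset (suc k)) →
    1 ≤ k → (∀ j → ∣ c j ∣ ≡ k) →
    (s : ℕ) → HasSize (InS k m c) s →
      (3 ≤ s → ZplusIs (cluster k m c) (suc k)) ×
      (s < 3 → ZplusIs (cluster k m c) k) ×
      (s ≡ suc k → 2 ∣ k → TreeCoverNumberIs (cluster k m c) (⌈ suc k /2⌉ + 1)) ×
      (s < suc k → 2 ∣ k → TreeCoverNumberIs (cluster k m c) ⌈ suc k /2⌉)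
theorem9p1 k m c 1≤k ∣c∣≡k s hs =
    (λ 3≤s → Z₊≡1+k 1≤k (three-missing 3≤s))
  , (λ s<3 → Z₊≡k 1≤k (¬three-missing s<3))
  , (λ s≡1+k 2∣k → T≡⌈1+k/2⌉+1 k m c ∣c∣≡k 1≤k 2∣k (all-missed s≡1+k))
  , (λ s<1+k 2∣k → T≡⌈1+k/2⌉ k m c ∣c∣≡k 2∣k (some-unmissed s<1+k))
  where
    open Cluster k m c ∣c∣≡k
    open SizeOfS s hs
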